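{- Let $G=(V,E)$ be a connected graph with at least one edge, let $\mathcal{T}$ be its set of spanning trees (identified with their edge sets), and let $\mathcal{P}(E)=\{w\in\mathbb{R}_+^E:\sum_{e\in E}w_e=1\}$. Then there exists $$w^\star\in\arg\min_{w\in\mathcal{P}(E)}\ \max_{T\in\mathcal{T}}\sum_{e\in E}\mathbf 1(e\in T)\,w_e$$ such that all non-zero components of $w^\star$ are equal.
   Formalization: The weight vectors of $\mathcal{P}(E)$, both the minimiser $w^\star$ and every vector it is compared against in the argmin, have nonnegative rational entries instead of entries in $\mathbb{R}_+$. -}

module Defs where

open import Data.Nat using (ℕ; zero; suc)
open import Data.Fin using (Fin; zero; suc)
open import Data.Fin.Subset using (Subset; _∈_; _-_; ⊤)
open import Data.Bool using (if_then_else_)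
open import Data.Vec using (lookup)
open import Data.Product using (_×_)
open import Data.Sum using (_⊎_)
open import Relation.Binary.PropositionalEquality using (_≡_; _≢_)
open import Relation.Nullary using (¬_)
open import Data.Rational using (ℚ; 0ℚ; _+_)

record Graph : Set where
  field
    n m      : ℕ
    src tgt  : Fin m → Fin n
    loopless : ∀ e → src e ≢ tgt e
    simple   : ∀ e f →
               ((src e ≡ src f × tgt e ≡ tgt f) ⊎ (src e ≡ tgt f × tgt e ≡ src f)) →
               e ≡ f

module _ (G : Graph) where
  open Graph G

  Joins : Fin m → Fin n → Fin n → Set
  Joins e u w = (src e ≡ u × tgt e ≡ w) ⊎ (tgt e ≡ u × src e ≡ w)

  data Reach (S : Subset m) : Fin n → Fin n → Set where
    here : ∀ {u} → Reach S u u
    step : ∀ {u w v} (e : Fin m) → e ∈ S → Joins e u w → Reach S w v → Reach S u v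

  ConnectedEdges : Subset m → Set
  ConnectedEdges S = ∀ u v → Reach S u v

  Connected : Set
  Connected = ConnectedEdges ⊤

  -- S is the edge set of a spanning tree: (V,S) is connected and acyclic,
  -- acyclicity expressed as: every edge of S is a bridge of (V,S)
  -- (i.e. (V,S) is minimally connected).
  SpanningTree : Subset m → Set
  SpanningTree T = ConnectedEdges T × (∀ e → e ∈ T → ¬ ConnectedEdges (T - e))

sumᶠ : ∀ {k} → (Fin k → ℚ) → ℚ
sumᶠ {zero}  f = 0ℚ
sumᶠ {suc k} f = f zero + sumᶠ (λ i → f (suc i))

treeWeight : ∀ {m} → Subset m → (Fin m → ℚ) → ℚ
treeWeight T w = sumᶠ (λ e → if lookup T e then w e else 0ℚ)

{-# OPTIONS --safe #-}
-- Call rank S = n − c(S) the rank of an edge set S, where c(S) is the number of components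
-- of (V, S); it is also the number of edges of S that Kruskal's algorithm keeps.  Let S⋆
-- maximise the density |S| / rank S.  The weighting w⋆ that is uniform on S⋆ gives every
-- spanning tree T the weight |T ∩ S⋆| / |S⋆| ≤ rank S⋆ / |S⋆|, because T ∩ S⋆ is a forest
-- inside S⋆.  Conversely, for any w in the simplex, Kruskal's algorithm offered the edges
-- from the heaviest down returns a spanning tree T′ containing exactly rank B edges of every
-- set B of heaviest edges.  Summation by parts along the edges in weight order turns the
-- density bounds rank S⋆ · |B| ≤ |S⋆| · rank B into rank S⋆ ≤ |S⋆| · w(T′), so w(T′) ≥ w⋆(T).
module Submission where

open import Defs
open import Data.Nat using (_<_)
open import Data.Fin using (Fin)
open import Data.Fin.Subset using (Subset)
open import Data.Product using (_×_; ∃; ∃-syntax)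
open import Relation.Binary.PropositionalEquality using (_≡_; _≢_)
open import Data.Rational using (ℚ; 0ℚ; 1ℚ; _≤_)

open import Algebra.Bundles using (CommutativeMonoid; CommutativeRing)
import Algebra.Properties.CommutativeSemigroup as CommutativeSemigroupProperties
import Algebra.Properties.Semiring.Mult as SemiringMult
open import Data.Bool using (true; false; if_then_else_)
open import Data.Fin using (zero; suc)
import Data.Fin as Fin
open import Data.Fin.Properties using (<-cmp; ≤-antisym; <⇒≢)
open import Data.Fin.Subset
  using (⊤; ⊥; ⁅_⁆; _∪_; _∩_; _-_; ∣_∣; _∈_; _∉_; _⊆_; inside; outside)
open import Data.Fin.Subset.Properties
  using ( _∈?_; nonempty?; Empty-unique; ∉⊥; ⊆⊤; ⊆-antisym; q⊆p∪q; ∪-identityˡ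
        ; x∈⁅x⁆; x∈⁅y⁆⇒x≡y; x∈p∪q⁺; x∈p∪q⁻; x∈p∩q⁻; x∈p∧x≢y⇒x∈p-y
        ; ∣⊥∣≡0; ∣⊤∣≡n; ∣⁅x⁆∣≡1; x∈p⇒∣p-x∣<∣p∣ )
open import Data.List using (List; []; _∷_; _++_; length; foldr; map; allFin; filter; tails)
open import Data.List.Membership.Propositional using () renaming (_∈_ to _∈ₗ_)
open import Data.List.Membership.Propositional.Properties
  using (∈-filter⁺; ∈-filter⁻; ∈-allFin; ∈-map⁺; ∈-++⁺ˡ; ∈-++⁺ʳ; ∈-++⁻)
open import Data.List.Relation.Binary.Permutation.Propositional using (↭-sym; ↭⇒↭ₛ)
open import Data.List.Relation.Binary.Permutation.Propositional.Properties using (∈-resp-↭)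
open import Data.List.Relation.Binary.Sublist.Propositional
  using ([]; _∷_; _∷ʳ_) renaming (_⊆_ to _⊑_)
open import Data.List.Relation.Binary.Sublist.Propositional.Properties
  using (All-resp-⊆; length-mono-≤)
open import Data.List.Relation.Unary.All using (All; []; _∷_)
import Data.List.Relation.Unary.All as All
open import Data.List.Relation.Unary.AllPairs using ([]; _∷_)
open import Data.List.Relation.Unary.Any using (here; there)
open import Data.List.Relation.Unary.Linked using (Linked; [-]; _∷_)
open import Data.List.Relation.Unary.Unique.Propositional using (Unique)
open import Data.List.Relation.Unary.Unique.Propositional.Properties
  using (filter⁺; allFin⁺; Unique[x∷xs]⇒x∉xs)
open import Data.Nat as ℕ using (ℕ)
import Data.Nat.Properties as ℕₚ
open import Data.Product using (_,_; proj₁; proj₂)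
import Data.Rational as ℚ
import Data.Rational.Properties as ℚₚ
open import Data.Rational.Solver using (module +-*-Solver)
open import Data.Sum using (inj₁; inj₂)
open import Data.Vec using ([]; _∷_; lookup; tabulate; here; there)
open import Data.Vec.Properties using (lookup∘tabulate; []=⇒lookup; lookup⇒[]=; tabulate-cong)
open import Function using (id; _∘_)
import Relation.Binary.Construct.On as On
open import Relation.Binary.Definitions using (tri<; tri≈; tri>)
open import Relation.Binary.PropositionalEquality
  using (refl; sym; trans; cong; subst; subst₂; module ≡-Reasoning)
  renaming (setoid to ≡-setoid)
open import Relation.Nullary using (¬_; contradiction; yes; no; does)
open import Relation.Nullary.Decidable using (dec-true; dec-false)

private variable
  k : ℕ
  x : Fin k
  p : Subset k
  xs : List (Fin k)

open SemiringMult (CommutativeRing.semiring ℚₚ.+-*-commutativeRing)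
  using (×1-homo-*) renaming (_×_ to _·_)
open CommutativeSemigroupProperties
  (CommutativeMonoid.commutativeSemigroup ℚₚ.+-0-commutativeMonoid)
  using (x∙yz≈y∙xz)
open CommutativeSemigroupProperties ℕₚ.*-commutativeSemigroup
  using () renaming (xy∙z≈xz∙y to [xy]z≡[xz]y)

ι : ℕ → ℚ
ι n = n · 1ℚ

ι-* : ∀ a b → ι (a ℕ.* b) ≡ ι a ℚ.* ι b
ι-* = ×1-homo-*

ι-nonNeg : ∀ a → 0ℚ ≤ ι a
ι-nonNeg ℕ.zero = ℚₚ.≤-refl
ι-nonNeg (ℕ.suc a) = ℚₚ.+-mono-≤ (ℚₚ.nonNegative⁻¹ 1ℚ) (ι-nonNeg a)

ι-mono : ∀ {a b} → a ℕ.≤ b → ι a ≤ ι b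
ι-mono {b = b} ℕ.z≤n = ι-nonNeg b
ι-mono (ℕ.s≤s a≤b) = ℚₚ.+-monoʳ-≤ 1ℚ (ι-mono a≤b)

ι-positive : ∀ a .{{_ : ℕ.NonZero a}} → ℚ.Positive (ι a)
ι-positive (ℕ.suc a) = ℚ.positive (ℚₚ.+-mono-<-≤ (ℚₚ.positive⁻¹ 1ℚ) (ι-nonNeg a))

0≤p-q⇒q≤p : ∀ {p q} → 0ℚ ≤ p ℚ.- q → q ≤ p
0≤p-q⇒q≤p {p} {q} 0≤p-q = begin
  q               ≡⟨ ℚₚ.+-identityˡ q ⟨
  0ℚ ℚ.+ q        ≤⟨ ℚₚ.+-monoˡ-≤ q 0≤p-q ⟩
  p ℚ.- q ℚ.+ q   ≡⟨ solve 2 (λ p q → p :- q :+ q := p) refl p q ⟩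
  p               ∎
  where
  open ℚₚ.≤-Reasoning
  open +-*-Solver

q≤p⇒0≤p-q : ∀ {p q} → q ≤ p → 0ℚ ≤ p ℚ.- q
q≤p⇒0≤p-q {p} {q} q≤p = begin
  0ℚ        ≡⟨ ℚₚ.+-inverseʳ q ⟨
  q ℚ.- q   ≤⟨ ℚₚ.+-monoˡ-≤ (ℚ.- q) q≤p ⟩
  p ℚ.- q   ∎
  where open ℚₚ.≤-Reasoning

*-nonNeg : ∀ {p q} → 0ℚ ≤ p → 0ℚ ≤ q → 0ℚ ≤ p ℚ.* q
*-nonNeg {p} {q} 0≤p 0≤q = ℚₚ.nonNegative⁻¹ (p ℚ.* q)
  {{ℚₚ.nonNeg*nonNeg⇒nonNeg p {{ℚ.nonNegative 0≤p}} q {{ℚ.nonNegative 0≤q}}}}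

p≤r*q⇒p*1/r≤q : ∀ {p q} r .{{_ : ℚ.Positive r}} →
                p ≤ r ℚ.* q → p ℚ.* (ℚ.1/ r) {{ℚₚ.pos⇒nonZero r}} ≤ q
p≤r*q⇒p*1/r≤q {p} {q} r p≤rq = begin
  p ℚ.* r⁻¹          ≤⟨ ℚₚ.*-monoʳ-≤-nonNeg r⁻¹ {{ℚₚ.pos⇒nonNeg r⁻¹ {{ℚₚ.1/pos⇒pos r}}}} p≤rq ⟩
  r ℚ.* q ℚ.* r⁻¹    ≡⟨ cong (ℚ._* r⁻¹) (ℚₚ.*-comm r q) ⟩
  q ℚ.* r ℚ.* r⁻¹    ≡⟨ ℚₚ.*-assoc q r r⁻¹ ⟩
  q ℚ.* (r ℚ.* r⁻¹)  ≡⟨ cong (q ℚ.*_) (ℚₚ.*-inverseʳ r {{ℚₚ.pos⇒nonZero r}}) ⟩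
  q ℚ.* 1ℚ           ≡⟨ ℚₚ.*-identityʳ q ⟩
  q                  ∎
  where
  open ℚₚ.≤-Reasoning
  r⁻¹ = (ℚ.1/ r) {{ℚₚ.pos⇒nonZero r}}

toSubset : List (Fin k) → Subset k
toSubset = foldr (λ x p → ⁅ x ⁆ ∪ p) ⊥

∈-toSubset⁺ : x ∈ₗ xs → x ∈ toSubset xs
∈-toSubset⁺ {x = x} (here refl) = x∈p∪q⁺ (inj₁ (x∈⁅x⁆ x))
∈-toSubset⁺ (there x∈xs) = x∈p∪q⁺ (inj₂ (∈-toSubset⁺ x∈xs))

∈-toSubset⁻ : x ∈ toSubset xs → x ∈ₗ xs
∈-toSubset⁻ {xs = []} x∈⊥ = contradiction x∈⊥ ∉⊥
∈-toSubset⁻ {xs = y ∷ ys} x∈ with x∈p∪q⁻ ⁅ y ⁆ (toSubset ys) x∈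
... | inj₁ x∈⁅y⁆ = here (x∈⁅y⁆⇒x≡y y x∈⁅y⁆)
... | inj₂ x∈ys = there (∈-toSubset⁻ x∈ys)

members : Subset k → List (Fin k)
members p = filter (_∈? p) (allFin _)

∈-members⁺ : x ∈ p → x ∈ₗ members p
∈-members⁺ {x = x} {p = p} x∈p = ∈-filter⁺ (_∈? p) (∈-allFin x) x∈p

∈-members⁻ : x ∈ₗ members p → x ∈ p
∈-members⁻ {k} {p = p} = proj₂ ∘ ∈-filter⁻ (_∈? p) {xs = allFin k}

members-unique : ∀ (p : Subset k) → Unique (members p)
members-unique {k} p = filter⁺ (_∈? p) (allFin⁺ k)

toSubset-members : ∀ (p : Subset k) → toSubset (members p) ≡ p
toSubset-members p = ⊆-antisym (∈-members⁻ ∘ ∈-toSubset⁻) (∈-toSubset⁺ ∘ ∈-members⁺)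

∉-toSubset : Unique (x ∷ xs) → x ∉ toSubset xs
∉-toSubset u = Unique[x∷xs]⇒x∉xs u ∘ ∈-toSubset⁻

∣⁅x⁆∪p∣ : x ∉ p → ∣ ⁅ x ⁆ ∪ p ∣ ≡ ℕ.suc ∣ p ∣
∣⁅x⁆∪p∣ {x = zero} {p = inside ∷ p} x∉p = contradiction here x∉p
∣⁅x⁆∪p∣ {x = zero} {p = outside ∷ p} _ = cong ℕ.suc (cong ∣_∣ (∪-identityˡ p))
∣⁅x⁆∪p∣ {x = suc x} {p = inside ∷ p} x∉p = cong ℕ.suc (∣⁅x⁆∪p∣ (x∉p ∘ there))
∣⁅x⁆∪p∣ {x = suc x} {p = outside ∷ p} x∉p = ∣⁅x⁆∪p∣ (x∉p ∘ there)

∣toSubset∣ : Unique xs → ∣ toSubset xs ∣ ≡ length xs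
∣toSubset∣ {k} [] = ∣⊥∣≡0 k
∣toSubset∣ (x∉xs ∷ u) = trans (∣⁅x⁆∪p∣ (∉-toSubset (x∉xs ∷ u))) (cong ℕ.suc (∣toSubset∣ u))

length-members : ∀ (p : Subset k) → length (members p) ≡ ∣ p ∣
length-members p = trans (sym (∣toSubset∣ (members-unique p))) (cong ∣_∣ (toSubset-members p))

tails-unique : Unique xs → All Unique (tails xs)
tails-unique [] = [] ∷ []
tails-unique (x∉xs ∷ u) = (x∉xs ∷ u) ∷ tails-unique u

allSubsets : ∀ k → List (Subset k)
allSubsets ℕ.zero = [] ∷ []
allSubsets (ℕ.suc k) = map (inside ∷_) (allSubsets k) ++ map (outside ∷_) (allSubsets k)

∈-allSubsets : ∀ (p : Subset k) → p ∈ₗ allSubsets k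
∈-allSubsets [] = here refl
∈-allSubsets (inside ∷ p) = ∈-++⁺ˡ (∈-map⁺ (inside ∷_) (∈-allSubsets p))
∈-allSubsets {ℕ.suc k} (outside ∷ p) =
  ∈-++⁺ʳ (map (inside ∷_) (allSubsets k)) (∈-map⁺ (outside ∷_) (∈-allSubsets p))

sumᴸ : {A : Set} → (A → ℚ) → List A → ℚ
sumᴸ f = foldr (λ x s → f x ℚ.+ s) 0ℚ

treeWeight-⊥ : ∀ (f : Fin k → ℚ) → treeWeight ⊥ f ≡ 0ℚ
treeWeight-⊥ {ℕ.zero} f = refl
treeWeight-⊥ {ℕ.suc k} f = trans (ℚₚ.+-identityˡ _) (treeWeight-⊥ (f ∘ suc))

treeWeight-⊤ : ∀ (f : Fin k → ℚ) → treeWeight ⊤ f ≡ sumᶠ f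
treeWeight-⊤ {ℕ.zero} f = refl
treeWeight-⊤ {ℕ.suc k} f = cong (f zero ℚ.+_) (treeWeight-⊤ (f ∘ suc))

treeWeight-⁅x⁆∪p : ∀ (f : Fin k → ℚ) → x ∉ p → treeWeight (⁅ x ⁆ ∪ p) f ≡ f x ℚ.+ treeWeight p f
treeWeight-⁅x⁆∪p {x = zero} {p = inside ∷ p} f x∉p = contradiction here x∉p
treeWeight-⁅x⁆∪p {x = zero} {p = outside ∷ p} f _ = cong (f zero ℚ.+_) (begin
  treeWeight (⊥ ∪ p) (f ∘ suc)   ≡⟨ cong (λ q → treeWeight q (f ∘ suc)) (∪-identityˡ p) ⟩
  treeWeight p (f ∘ suc)         ≡⟨ ℚₚ.+-identityˡ _ ⟨
  0ℚ ℚ.+ treeWeight p (f ∘ suc)  ∎)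
  where open ≡-Reasoning
treeWeight-⁅x⁆∪p {x = suc x} {p = b ∷ p} f x∉p = trans
  (cong ((if b then f zero else 0ℚ) ℚ.+_) (treeWeight-⁅x⁆∪p (f ∘ suc) (x∉p ∘ there)))
  (x∙yz≈y∙xz (if b then f zero else 0ℚ) (f (suc x)) _)

treeWeight-toSubset : ∀ (f : Fin k → ℚ) → Unique xs → treeWeight (toSubset xs) f ≡ sumᴸ f xs
treeWeight-toSubset f [] = treeWeight-⊥ f
treeWeight-toSubset {xs = x ∷ xs} f (x∉xs ∷ u) = trans
  (treeWeight-⁅x⁆∪p f (∉-toSubset (x∉xs ∷ u)))
  (cong (f x ℚ.+_) (treeWeight-toSubset f u))

treeWeight-∩ : ∀ (p q : Subset k) (f : Fin k → ℚ) →
               treeWeight p (λ e → if lookup q e then f e else 0ℚ) ≡ treeWeight (p ∩ q) f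
treeWeight-∩ [] [] f = refl
treeWeight-∩ (inside ∷ p) (b ∷ q) f =
  cong ((if b then f zero else 0ℚ) ℚ.+_) (treeWeight-∩ p q (f ∘ suc))
treeWeight-∩ (outside ∷ p) (b ∷ q) f = cong (0ℚ ℚ.+_) (treeWeight-∩ p q (f ∘ suc))

treeWeight-const : ∀ (p : Subset k) c → treeWeight p (λ _ → c) ≡ ι ∣ p ∣ ℚ.* c
treeWeight-const [] c = sym (ℚₚ.*-zeroˡ c)
treeWeight-const (inside ∷ p) c = trans (cong (c ℚ.+_) (treeWeight-const p c))
  (solve 2 (λ c n → c :+ n :* c := (con 1ℚ :+ n) :* c) refl c (ι ∣ p ∣))
  where open +-*-Solver
treeWeight-const (outside ∷ p) c = trans (ℚₚ.+-identityˡ _) (treeWeight-const p c)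

uniform : Subset k → ℚ → Fin k → ℚ
uniform S c e = if lookup S e then c else 0ℚ

uniform-nonNeg : ∀ (S : Subset k) {c} → 0ℚ ≤ c → ∀ e → 0ℚ ≤ uniform S c e
uniform-nonNeg S 0≤c e with lookup S e
... | true = 0≤c
... | false = ℚₚ.≤-refl

uniform-equal : ∀ (S : Subset k) c e f → uniform S c e ≢ 0ℚ → uniform S c f ≢ 0ℚ →
                uniform S c e ≡ uniform S c f
uniform-equal S c e f e≢0 f≢0 with lookup S e | lookup S f
... | true | true = refl
... | false | _ = contradiction refl e≢0
... | true | false = contradiction refl f≢0

treeWeight-uniform : ∀ (T S : Subset k) c → treeWeight T (uniform S c) ≡ ι ∣ T ∩ S ∣ ℚ.* c
treeWeight-uniform T S c = trans (treeWeight-∩ T S (λ _ → c)) (treeWeight-const (T ∩ S) c)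

module SummationByParts {A : Set} (w : A → ℚ) (d : A → List A → ℚ) where
  open import Data.Rational using (_+_; _*_)

  Σd : List A → ℚ
  Σd [] = 0ℚ
  Σd (x ∷ xs) = d x xs + Σd xs

  Σwd : List A → ℚ
  Σwd [] = 0ℚ
  Σwd (x ∷ xs) = w x * d x xs + Σwd xs

  w[x]*Σd≤Σwd : ∀ {x xs} → Linked (λ a b → w a ≤ w b) (x ∷ xs) →
                All (λ ys → 0ℚ ≤ Σd ys) (tails xs) → w x * Σd (x ∷ xs) ≤ Σwd (x ∷ xs)
  w[x]*Σd≤Σwd {x} {[]} [-] _ = ℚₚ.≤-reflexive
    (trans (cong (w x *_) (ℚₚ.+-identityʳ (d x []))) (sym (ℚₚ.+-identityʳ _)))
  w[x]*Σd≤Σwd {x} {y ∷ ys} (wx≤wy ∷ sorted) (0≤D ∷ 0≤tails) = begin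
    w x * (dx + D)     ≡⟨ ℚₚ.*-distribˡ-+ (w x) dx D ⟩
    w x * dx + w x * D  ≤⟨ ℚₚ.+-monoʳ-≤ (w x * dx) (ℚₚ.*-monoʳ-≤-nonNeg D {{ℚ.nonNegative 0≤D}} wx≤wy) ⟩
    w x * dx + w y * D  ≤⟨ ℚₚ.+-monoʳ-≤ (w x * dx) (w[x]*Σd≤Σwd sorted 0≤tails) ⟩
    w x * dx + Σwd (y ∷ ys) ∎
    where
    open ℚₚ.≤-Reasoning
    dx = d x (y ∷ ys)
    D = Σd (y ∷ ys)

  Σwd-nonNeg : ∀ {xs} → Linked (λ a b → w a ≤ w b) xs → (∀ x → 0ℚ ≤ w x) →
               All (λ ys → 0ℚ ≤ Σd ys) (tails xs) → 0ℚ ≤ Σwd xs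
  Σwd-nonNeg {[]} _ _ _ = ℚₚ.≤-refl
  Σwd-nonNeg {x ∷ xs} sorted 0≤w (0≤D ∷ 0≤tails) =
    ℚₚ.≤-trans (*-nonNeg (0≤w x) 0≤D) (w[x]*Σd≤Σwd sorted 0≤tails)

module Densest {A : Set} (num den : A → ℕ) (den≢0 : ∀ a → ℕ.NonZero (den a)) where
  open import Data.Nat using (_*_)

  _≼_ : A → A → Set
  a ≼ b = num a * den b ℕ.≤ num b * den a

  ≼-trans : ∀ {a b c} → a ≼ b → b ≼ c → a ≼ c
  ≼-trans {a} {b} {c} a≼b b≼c = ℕₚ.*-cancelʳ-≤ _ _ (den b) {{den≢0 b}} (begin
    num a * den c * den b  ≡⟨ [xy]z≡[xz]y (num a) (den c) (den b) ⟩
    num a * den b * den c  ≤⟨ ℕₚ.*-monoˡ-≤ (den c) a≼b ⟩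
    num b * den a * den c  ≡⟨ [xy]z≡[xz]y (num b) (den a) (den c) ⟩
    num b * den c * den a  ≤⟨ ℕₚ.*-monoˡ-≤ (den a) b≼c ⟩
    num c * den b * den a  ≡⟨ [xy]z≡[xz]y (num c) (den b) (den a) ⟩
    num c * den a * den b  ∎)
    where open ℕₚ.≤-Reasoning

  densest : A → List A → A
  densest a [] = a
  densest a (b ∷ bs) with num a * den b ℕₚ.≤? num b * den a
  ... | yes _ = densest b bs
  ... | no _ = densest a bs

  densest-greatest : ∀ a bs → All (_≼ densest a bs) (a ∷ bs)
  densest-greatest a [] = ℕₚ.≤-refl ∷ []
  densest-greatest a (b ∷ bs) with num a * den b ℕₚ.≤? num b * den a
  ... | yes a≼b with densest-greatest b bs
  ...   | b≼d ∷ bs≼d = ≼-trans a≼b b≼d ∷ b≼d ∷ bs≼d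
  densest-greatest a (b ∷ bs) | no a⋠b with densest-greatest a bs
  ...   | a≼d ∷ bs≼d = a≼d ∷ ≼-trans (ℕₚ.≰⇒≥ a⋠b) a≼d ∷ bs≼d

module SortByWeight {k} (w : Fin k → ℚ) where
  open import Data.List.Sort (On.decTotalOrder ℚₚ.≤-decTotalOrder w) using (sort; sort-↭; sort-↗)
  open import Data.List.Relation.Binary.Permutation.Setoid.Properties (≡-setoid (Fin k))
    using (Unique-resp-↭)

  byWeight : List (Fin k)
  byWeight = sort (allFin k)

  byWeight-sorted : Linked (λ e f → w e ≤ w f) byWeight
  byWeight-sorted = sort-↗ (allFin k)

  byWeight-unique : Unique byWeight
  byWeight-unique = Unique-resp-↭ (↭⇒↭ₛ (↭-sym (sort-↭ (allFin k)))) (allFin⁺ k)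

  ∈-byWeight : ∀ e → e ∈ₗ byWeight
  ∈-byWeight e = ∈-resp-↭ (↭-sym (sort-↭ (allFin k))) (∈-allFin e)

open SortByWeight using (byWeight; byWeight-sorted; byWeight-unique; ∈-byWeight)

module _ (G : Graph) where
  open Graph G
  open import Data.Nat using (_+_; _*_)

  private variable
    S : Subset m
    e : Fin m
    u v : Fin n
    lab : Fin n → Fin n

  Joins-sym : ∀ {u v} → Joins G e u v → Joins G e v u
  Joins-sym (inj₁ (s≡u , t≡v)) = inj₂ (t≡v , s≡u)
  Joins-sym (inj₂ (t≡u , s≡v)) = inj₁ (s≡v , t≡u)

  Reach-trans : ∀ {u w v} → Reach G S u w → Reach G S w v → Reach G S u v
  Reach-trans here q = q
  Reach-trans (step e e∈S j p) q = step e e∈S j (Reach-trans p q)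

  Reach-sym : Reach G S u v → Reach G S v u
  Reach-sym here = here
  Reach-sym (step e e∈S j p) = Reach-trans (Reach-sym p) (step e e∈S (Joins-sym j) here)

  Reach-mono : ∀ {S′} → S ⊆ S′ → Reach G S u v → Reach G S′ u v
  Reach-mono S⊆S′ here = here
  Reach-mono S⊆S′ (step e e∈S j p) = step e (S⊆S′ e∈S) j (Reach-mono S⊆S′ p)

  Reach-along : Reach G S (src e) (tgt e) → Joins G e u v → Reach G S u v
  Reach-along p (inj₁ (refl , refl)) = p
  Reach-along p (inj₂ (refl , refl)) = Reach-sym p

  Reach-bypass : ∀ {S′} → Reach G S′ (src e) (tgt e) → (∀ {f} → f ∈ S → f ≢ e → f ∈ S′) →
                 Reach G S u v → Reach G S′ u v
  Reach-bypass around S-e⊆S′ here = here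
  Reach-bypass {e = e} around S-e⊆S′ (step f f∈S j p) with f Fin.≟ e
  ... | yes refl = Reach-trans (Reach-along around j) (Reach-bypass around S-e⊆S′ p)
  ... | no f≢e = step f (S-e⊆S′ f∈S f≢e) j (Reach-bypass around S-e⊆S′ p)

  -- The fields force lab v to be the least vertex of the component of v in (V, S); hence
  -- labellings are unique, and the components are counted by the fixed points of lab.
  record Labelling (S : Subset m) (lab : Fin n → Fin n) : Set where
    field
      reach-label : ∀ v → Reach G S (lab v) v
      label-≤     : ∀ v → lab v Fin.≤ v
      label-edge  : ∀ {e} → e ∈ S → lab (src e) ≡ lab (tgt e)

  module _ (L : Labelling S lab) where
    open Labelling L

    label-respects-Reach : Reach G S u v → lab u ≡ lab v
    label-respects-Reach here = refl
    label-respects-Reach (step e e∈S j p) = trans (across j) (label-respects-Reach p)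
      where
      across : ∀ {u w} → Joins G e u w → lab u ≡ lab w
      across (inj₁ (refl , refl)) = label-edge e∈S
      across (inj₂ (refl , refl)) = sym (label-edge e∈S)

    label-idem : ∀ v → lab (lab v) ≡ lab v
    label-idem v = label-respects-Reach (reach-label v)

    same-label⇒Reach : lab u ≡ lab v → Reach G S u v
    same-label⇒Reach {u} {v} eq =
      Reach-trans (Reach-sym (reach-label u)) (subst (λ r → Reach G S r v) (sym eq) (reach-label v))

  labelling-unique : ∀ {lab′} → Labelling S lab → Labelling S lab′ → ∀ v → lab v ≡ lab′ v
  labelling-unique L L′ v = ≤-antisym (least L L′) (least L′ L)
    where
    least : ∀ {l₁ l₂} → Labelling S l₁ → Labelling S l₂ → l₁ v Fin.≤ l₂ v
    least {l₁ = l₁} {l₂ = l₂} L₁ L₂ = subst (Fin._≤ l₂ v)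
      (label-respects-Reach L₁ (Labelling.reach-label L₂ v)) (Labelling.label-≤ L₁ (l₂ v))

  roots : (Fin n → Fin n) → Subset n
  roots lab = tabulate (λ v → does (lab v Fin.≟ v))

  components : (Fin n → Fin n) → ℕ
  components lab = ∣ roots lab ∣

  ∈-roots⁺ : ∀ lab → lab v ≡ v → v ∈ roots lab
  ∈-roots⁺ {v} lab eq =
    lookup⇒[]= v (roots lab) (trans (lookup∘tabulate _ v) (dec-true (lab v Fin.≟ v) eq))

  ∈-roots⁻ : ∀ lab → v ∈ roots lab → lab v ≡ v
  ∈-roots⁻ {v} lab v∈ with lab v Fin.≟ v | trans (sym (lookup∘tabulate _ v)) ([]=⇒lookup v∈)
  ... | yes eq | _ = eq
  ... | no _ | ()

  components-unique : ∀ {lab′} → Labelling S lab → Labelling S lab′ →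
                      components lab ≡ components lab′
  components-unique L L′ =
    cong ∣_∣ (tabulate-cong (λ v → cong (λ r → does (r Fin.≟ v)) (labelling-unique L L′ v)))

  components-id : components id ≡ n
  components-id = trans (cong ∣_∣ (⊆-antisym ⊆⊤ (λ _ → ∈-roots⁺ id refl))) (∣⊤∣≡n n)

  components-connected : Fin n → ConnectedEdges G S → Labelling S lab → components lab ≡ 1
  components-connected {lab = lab} v₀ connected L =
    trans (cong ∣_∣ (⊆-antisym roots⊆ ⁅r⁆⊆)) (∣⁅x⁆∣≡1 (lab v₀))
    where
    roots⊆ : roots lab ⊆ ⁅ lab v₀ ⁆
    roots⊆ {v} v∈ = subst (_∈ ⁅ lab v₀ ⁆)
      (trans (sym (label-respects-Reach L (connected v v₀))) (∈-roots⁻ lab v∈)) (x∈⁅x⁆ (lab v₀))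
    ⁅r⁆⊆ : ⁅ lab v₀ ⁆ ⊆ roots lab
    ⁅r⁆⊆ v∈ = subst (_∈ roots lab) (sym (x∈⁅y⁆⇒x≡y _ v∈)) (∈-roots⁺ lab (label-idem L v₀))

  relabel : Fin n → Fin n → (Fin n → Fin n) → Fin n → Fin n
  relabel old new lab v = if does (lab v Fin.≟ old) then new else lab v

  relabel-old : ∀ lab v {old new} → lab v ≡ old → relabel old new lab v ≡ new
  relabel-old lab v {old} {new} eq =
    cong (λ b → if b then new else lab v) (dec-true (lab v Fin.≟ old) eq)

  relabel-other : ∀ lab v {old new} → lab v ≢ old → relabel old new lab v ≡ lab v
  relabel-other lab v {old} {new} ne =
    cong (λ b → if b then new else lab v) (dec-false (lab v Fin.≟ old) ne)

  extend-labelling : Labelling S lab → lab (src e) ≡ lab (tgt e) → Labelling (⁅ e ⁆ ∪ S) lab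
  extend-labelling {S} {lab} {e} L joined = record
    { reach-label = λ v → Reach-mono (q⊆p∪q ⁅ e ⁆ S) (reach-label v)
    ; label-≤     = label-≤
    ; label-edge  = edge
    }
    where
    open Labelling L
    edge : ∀ {f} → f ∈ ⁅ e ⁆ ∪ S → lab (src f) ≡ lab (tgt f)
    edge f∈ with x∈p∪q⁻ ⁅ e ⁆ S f∈
    ... | inj₁ f∈⁅e⁆ rewrite x∈⁅y⁆⇒x≡y e f∈⁅e⁆ = joined
    ... | inj₂ f∈S = label-edge f∈S

  module _ {p q} (L : Labelling S lab) (e-joins : Joins G e p q) (q<p : lab q Fin.< lab p) where
    open Labelling L

    private
      lab′ : Fin n → Fin n
      lab′ = relabel (lab p) (lab q) lab

      new≢old : lab q ≢ lab p
      new≢old = <⇒≢ q<p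

      lab′-p : lab′ p ≡ lab q
      lab′-p = relabel-old lab p refl

      lab′-q : lab′ q ≡ lab q
      lab′-q = relabel-other lab q new≢old

    relabel-labelling : Labelling (⁅ e ⁆ ∪ S) lab′
    relabel-labelling = record { reach-label = reach ; label-≤ = least ; label-edge = edge }
      where
      S⊆ : S ⊆ ⁅ e ⁆ ∪ S
      S⊆ = q⊆p∪q ⁅ e ⁆ S

      reach : ∀ v → Reach G (⁅ e ⁆ ∪ S) (lab′ v) v
      reach v with lab v Fin.≟ lab p
      ... | yes eq = Reach-trans (Reach-mono S⊆ (reach-label q))
                       (step e (x∈p∪q⁺ (inj₁ (x∈⁅x⁆ e))) (Joins-sym e-joins)
                         (Reach-mono S⊆ (same-label⇒Reach L (sym eq))))
      ... | no _ = Reach-mono S⊆ (reach-label v)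

      least : ∀ v → lab′ v Fin.≤ v
      least v with lab v Fin.≟ lab p
      ... | yes eq = ℕₚ.≤-trans (ℕₚ.<⇒≤ q<p) (subst (Fin._≤ v) eq (label-≤ v))
      ... | no _ = label-≤ v

      ends : Joins G e p q → lab′ (src e) ≡ lab′ (tgt e)
      ends (inj₁ (s≡p , t≡q)) =
        trans (cong lab′ s≡p) (trans lab′-p (sym (trans (cong lab′ t≡q) lab′-q)))
      ends (inj₂ (t≡p , s≡q)) =
        trans (cong lab′ s≡q) (trans lab′-q (sym (trans (cong lab′ t≡p) lab′-p)))

      edge : ∀ {f} → f ∈ ⁅ e ⁆ ∪ S → lab′ (src f) ≡ lab′ (tgt f)
      edge f∈ with x∈p∪q⁻ ⁅ e ⁆ S f∈
      ... | inj₁ f∈⁅e⁆ rewrite x∈⁅y⁆⇒x≡y e f∈⁅e⁆ = ends e-joins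
      ... | inj₂ f∈S = cong (λ r → if does (r Fin.≟ lab p) then lab q else r) (label-edge f∈S)

    components-relabel : components lab ≡ ℕ.suc (components lab′)
    components-relabel = trans (cong ∣_∣ (⊆-antisym split merged)) (∣⁅x⁆∪p∣ old∉)
      where
      old∉ : lab p ∉ roots lab′
      old∉ old∈ =
        new≢old (trans (sym (relabel-old lab (lab p) (label-idem L p))) (∈-roots⁻ lab′ old∈))

      split : roots lab ⊆ ⁅ lab p ⁆ ∪ roots lab′
      split {v} v∈ with v Fin.≟ lab p
      ... | yes refl = x∈p∪q⁺ (inj₁ (x∈⁅x⁆ v))
      ... | no v≢old = x∈p∪q⁺ (inj₂ (∈-roots⁺ lab′ (trans (relabel-other lab v lab[v]≢old) v-root)))
        where
        v-root = ∈-roots⁻ lab v∈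
        lab[v]≢old = λ eq → v≢old (trans (sym v-root) eq)

      merged : ⁅ lab p ⁆ ∪ roots lab′ ⊆ roots lab
      merged {v} v∈ with x∈p∪q⁻ ⁅ lab p ⁆ (roots lab′) v∈
      ... | inj₁ v∈⁅old⁆ =
        subst (_∈ roots lab) (sym (x∈⁅y⁆⇒x≡y _ v∈⁅old⁆)) (∈-roots⁺ lab (label-idem L p))
      ... | inj₂ v∈roots′ with lab v Fin.≟ lab p
      ...   | yes eq =
        subst (_∈ roots lab) (trans (sym (relabel-old lab v eq)) (∈-roots⁻ lab′ v∈roots′))
              (∈-roots⁺ lab (label-idem L q))
      ...   | no ne = ∈-roots⁺ lab (trans (sym (relabel-other lab v ne)) (∈-roots⁻ lab′ v∈roots′))

  merge : Fin m → (Fin n → Fin n) → Fin n → Fin n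
  merge e lab with <-cmp (lab (src e)) (lab (tgt e))
  ... | tri< _ _ _ = relabel (lab (tgt e)) (lab (src e)) lab
  ... | tri≈ _ _ _ = lab
  ... | tri> _ _ _ = relabel (lab (src e)) (lab (tgt e)) lab

  merge-labelling : Labelling S lab → Labelling (⁅ e ⁆ ∪ S) (merge e lab)
  merge-labelling {lab = lab} {e = e} L with <-cmp (lab (src e)) (lab (tgt e))
  ... | tri< s<t _ _ = relabel-labelling L (inj₂ (refl , refl)) s<t
  ... | tri≈ _ joined _ = extend-labelling L joined
  ... | tri> _ _ t<s = relabel-labelling L (inj₁ (refl , refl)) t<s

  merge-joined : lab (src e) ≡ lab (tgt e) → merge e lab ≡ lab
  merge-joined {lab = lab} {e = e} joined with <-cmp (lab (src e)) (lab (tgt e))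
  ... | tri< s<t _ _ = contradiction joined (<⇒≢ s<t)
  ... | tri≈ _ _ _ = refl
  ... | tri> _ _ t<s = contradiction (sym joined) (<⇒≢ t<s)

  components-merge : Labelling S lab → lab (src e) ≢ lab (tgt e) →
                     components lab ≡ ℕ.suc (components (merge e lab))
  components-merge {lab = lab} {e = e} L apart with <-cmp (lab (src e)) (lab (tgt e))
  ... | tri< s<t _ _ = components-relabel L (inj₂ (refl , refl)) s<t
  ... | tri≈ _ joined _ = contradiction joined apart
  ... | tri> _ _ t<s = components-relabel L (inj₁ (refl , refl)) t<s

  -- Both add the edges of a list from its last element to its first.
  label : List (Fin m) → Fin n → Fin n
  label [] = id
  label (e ∷ es) = merge e (label es)

  kruskal : List (Fin m) → List (Fin m)
  kruskal [] = []
  kruskal (e ∷ es) =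
    if does (label es (src e) Fin.≟ label es (tgt e)) then kruskal es else e ∷ kruskal es

  label-labelling : ∀ xs → Labelling (toSubset xs) (label xs)
  label-labelling [] = record
    { reach-label = λ _ → here
    ; label-≤     = λ _ → ℕₚ.≤-refl
    ; label-edge  = λ e∈⊥ → contradiction e∈⊥ ∉⊥
    }
  label-labelling (e ∷ es) = merge-labelling (label-labelling es)

  label-kruskal : ∀ xs → label (kruskal xs) ≡ label xs
  label-kruskal [] = refl
  label-kruskal (e ∷ es) with label es (src e) Fin.≟ label es (tgt e)
  ... | yes joined = trans (label-kruskal es) (sym (merge-joined {lab = label es} joined))
  ... | no _ = cong (merge e) (label-kruskal es)

  length-kruskal+components : ∀ xs → length (kruskal xs) + components (label xs) ≡ n
  length-kruskal+components [] = components-id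
  length-kruskal+components (e ∷ es) with label es (src e) Fin.≟ label es (tgt e)
  ... | yes joined = trans
    (cong (λ l → length (kruskal es) + components l) (merge-joined {lab = label es} joined))
    (length-kruskal+components es)
  ... | no apart = begin
    ℕ.suc (length (kruskal es)) + components (merge e (label es))
      ≡⟨ ℕₚ.+-suc (length (kruskal es)) _ ⟨
    length (kruskal es) + ℕ.suc (components (merge e (label es)))
      ≡⟨ cong (length (kruskal es) +_) (components-merge {e = e} (label-labelling es) apart) ⟨
    length (kruskal es) + components (label es)
      ≡⟨ length-kruskal+components es ⟩
    n ∎
    where open ≡-Reasoning

  kruskal-sublist : ∀ xs → kruskal xs ⊑ xs
  kruskal-sublist [] = []
  kruskal-sublist (e ∷ es) with label es (src e) Fin.≟ label es (tgt e)
  ... | yes _ = e ∷ʳ kruskal-sublist es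
  ... | no _ = refl ∷ kruskal-sublist es

  kruskal-unique : Unique xs → Unique (kruskal xs)
  kruskal-unique {xs = []} [] = []
  kruskal-unique {xs = e ∷ es} (e∉es ∷ u) with label es (src e) Fin.≟ label es (tgt e)
  ... | yes _ = kruskal-unique u
  ... | no _ = All-resp-⊆ (kruskal-sublist es) e∉es ∷ kruskal-unique u

  length-kruskal-++ : ∀ xs ys → length (kruskal ys) ℕ.≤ length (kruskal (xs ++ ys))
  length-kruskal-++ [] ys = ℕₚ.≤-refl
  length-kruskal-++ (e ∷ es) ys with label (es ++ ys) (src e) Fin.≟ label (es ++ ys) (tgt e)
  ... | yes _ = length-kruskal-++ es ys
  ... | no _ = ℕₚ.m≤n⇒m≤1+n (length-kruskal-++ es ys)

  kruskal-nonempty : ∀ e es → 1 ℕ.≤ length (kruskal (e ∷ es))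
  kruskal-nonempty e [] with src e Fin.≟ tgt e
  ... | yes loop = contradiction loop (loopless e)
  ... | no _ = ℕₚ.≤-refl
  kruskal-nonempty e (f ∷ fs) =
    ℕₚ.≤-trans (kruskal-nonempty f fs) (length-kruskal-++ (e ∷ []) (f ∷ fs))

  length-kruskal-cong : ∀ xs ys → toSubset xs ≡ toSubset ys →
                        length (kruskal xs) ≡ length (kruskal ys)
  length-kruskal-cong xs ys eq = ℕₚ.+-cancelʳ-≡ (components (label xs)) _ _ (begin
    length (kruskal xs) + components (label xs)  ≡⟨ length-kruskal+components xs ⟩
    n                                            ≡⟨ length-kruskal+components ys ⟨
    length (kruskal ys) + components (label ys)  ≡⟨ cong (length (kruskal ys) +_) (components-unique Lys Lxs) ⟩
    length (kruskal ys) + components (label xs)  ∎)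
    where
    open ≡-Reasoning
    Lxs : Labelling (toSubset ys) (label xs)
    Lxs = subst (λ S → Labelling S (label xs)) eq (label-labelling xs)
    Lys = label-labelling ys

  length-kruskal-connected : ∀ xs → Fin n → ConnectedEdges G (toSubset xs) →
                             length (kruskal xs) + 1 ≡ n
  length-kruskal-connected xs v₀ connected = trans
    (cong (length (kruskal xs) +_) (sym (components-connected v₀ connected (label-labelling xs))))
    (length-kruskal+components xs)

  rank : Subset m → ℕ
  rank S = length (kruskal (members S))

  DensityAtMost : ℕ → ℕ → Set
  DensityAtMost s r = ∀ B → r * ∣ B ∣ ℕ.≤ s * rank B

  rank-toSubset : ∀ xs → rank (toSubset xs) ≡ length (kruskal xs)
  rank-toSubset xs = length-kruskal-cong (members (toSubset xs)) xs (toSubset-members (toSubset xs))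

  rank-pos : e ∈ S → 1 ℕ.≤ rank S
  rank-pos {S = S} e∈S with members S | ∈-members⁺ e∈S
  ... | f ∷ fs | _ = kruskal-nonempty f fs

  kruskal-forest : ∀ {T ys} → SpanningTree G T → Unique ys → All (_∈ T) ys → kruskal ys ≡ ys
  kruskal-forest tree [] [] = refl
  kruskal-forest {T} {e ∷ es} tree (e∉es ∷ u) (e∈T ∷ es⊆T)
    with label es (src e) Fin.≟ label es (tgt e)
  ... | no _ = cong (e ∷_) (kruskal-forest tree u es⊆T)
  ... | yes joined = contradiction T-e-connected (proj₂ tree e e∈T)
    where
    es⊆T-e : toSubset es ⊆ T - e
    es⊆T-e f∈ = let f∈es = ∈-toSubset⁻ f∈ in
      x∈p∧x≢y⇒x∈p-y (All.lookup es⊆T f∈es) (All.lookup e∉es f∈es ∘ sym)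
    T-e-connected : ConnectedEdges G (T - e)
    T-e-connected u v = Reach-bypass
      (Reach-mono es⊆T-e (same-label⇒Reach (label-labelling es) joined))
      x∈p∧x≢y⇒x∈p-y (proj₁ tree u v)

  forest-bound : ∀ {T} → SpanningTree G T → ∀ S → ∣ T ∩ S ∣ ℕ.≤ rank S
  forest-bound {T} tree S = begin
    ∣ T ∩ S ∣                          ≡⟨ length-members (T ∩ S) ⟨
    length shared                      ≡⟨ cong length (kruskal-forest tree (members-unique (T ∩ S)) shared⊆T) ⟨
    length (kruskal shared)            ≤⟨ length-kruskal-++ edges shared ⟩
    length (kruskal (edges ++ shared)) ≡⟨ length-kruskal-cong (edges ++ shared) edges (⊆-antisym ⊆S ⊇S) ⟩
    rank S                             ∎
    where
    open ℕₚ.≤-Reasoning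
    edges = members S
    shared = members (T ∩ S)
    shared⊆T : All (_∈ T) shared
    shared⊆T = All.tabulate (λ f∈ → proj₁ (x∈p∩q⁻ T S (∈-members⁻ f∈)))
    ⊆S : toSubset (edges ++ shared) ⊆ toSubset edges
    ⊆S f∈ with ∈-++⁻ edges (∈-toSubset⁻ f∈)
    ... | inj₁ f∈edges = ∈-toSubset⁺ f∈edges
    ... | inj₂ f∈shared = ∈-toSubset⁺ (∈-members⁺ (proj₂ (x∈p∩q⁻ T S (∈-members⁻ f∈shared))))
    ⊇S : toSubset edges ⊆ toSubset (edges ++ shared)
    ⊇S f∈ = ∈-toSubset⁺ (∈-++⁺ˡ {xs = edges} {ys = shared} (∈-toSubset⁻ f∈))

  kruskal-spanningTree : Connected G → Fin n → ∀ {L} → Unique L → (∀ e → e ∈ₗ L) →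
                         SpanningTree G (toSubset (kruskal L))
  kruskal-spanningTree connected v₀ {L} u covers = spanning , bridges
    where
    L-connected : ConnectedEdges G (toSubset L)
    L-connected u v = Reach-mono (λ {e} _ → ∈-toSubset⁺ (covers e)) (connected u v)

    spanning : ConnectedEdges G (toSubset (kruskal L))
    spanning u v = same-label⇒Reach
      (subst (Labelling _) (label-kruskal L) (label-labelling (kruskal L)))
      (label-respects-Reach (label-labelling L) (L-connected u v))

    bridges : ∀ e → e ∈ toSubset (kruskal L) → ¬ ConnectedEdges G (toSubset (kruskal L) - e)
    bridges e e∈T T-e-connected = ℕₚ.<-irrefl same-length shorter
      where
      T = toSubset (kruskal L)
      R = members (T - e)
      same-length : length (kruskal R) ≡ length (kruskal L)
      same-length = ℕₚ.+-cancelʳ-≡ 1 _ _ (trans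
        (length-kruskal-connected R v₀ (subst (ConnectedEdges G) (sym (toSubset-members (T - e)))
                                               T-e-connected))
        (sym (length-kruskal-connected L v₀ L-connected)))
      shorter : length (kruskal R) ℕ.< length (kruskal L)
      shorter = begin-strict
        length (kruskal R)  ≤⟨ length-mono-≤ (kruskal-sublist R) ⟩
        length R            ≡⟨ length-members (T - e) ⟩
        ∣ T - e ∣           <⟨ x∈p⇒∣p-x∣<∣p∣ e∈T ⟩
        ∣ T ∣               ≡⟨ ∣toSubset∣ (kruskal-unique u) ⟩
        length (kruskal L)  ∎
        where open ℕₚ.≤-Reasoning

  module _ (w : Fin m → ℚ) {r s : ℕ} (dense : DensityAtMost s r) where
    gain : Fin m → List (Fin m) → ℚ
    gain e es = (if does (label es (src e) Fin.≟ label es (tgt e)) then 0ℚ else ι s) ℚ.- ι r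

    open SummationByParts w gain
    open +-*-Solver

    Σgain : ∀ es → Σd es ≡ ι s ℚ.* ι (length (kruskal es)) ℚ.- ι r ℚ.* ι (length es)
    Σgain [] = solve 2 (λ S R → con 0ℚ := S :* con 0ℚ :- R :* con 0ℚ) refl (ι s) (ι r)
    Σgain (e ∷ es) with label es (src e) Fin.≟ label es (tgt e)
    ... | yes _ = trans (cong ((0ℚ ℚ.- ι r) ℚ.+_) (Σgain es))
      (solve 4 (λ S R K N → (con 0ℚ :- R) :+ (S :* K :- R :* N) := S :* K :- R :* (con 1ℚ :+ N))
             refl (ι s) (ι r) (ι (length (kruskal es))) (ι (length es)))
    ... | no _ = trans (cong ((ι s ℚ.- ι r) ℚ.+_) (Σgain es))
      (solve 4 (λ S R K N → (S :- R) :+ (S :* K :- R :* N) := S :* (con 1ℚ :+ K) :- R :* (con 1ℚ :+ N))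
             refl (ι s) (ι r) (ι (length (kruskal es))) (ι (length es)))

    Σw·gain : ∀ es → Σwd es ≡ ι s ℚ.* sumᴸ w (kruskal es) ℚ.- ι r ℚ.* sumᴸ w es
    Σw·gain [] = solve 2 (λ S R → con 0ℚ := S :* con 0ℚ :- R :* con 0ℚ) refl (ι s) (ι r)
    Σw·gain (e ∷ es) with label es (src e) Fin.≟ label es (tgt e)
    ... | yes _ = trans (cong (w e ℚ.* (0ℚ ℚ.- ι r) ℚ.+_) (Σw·gain es))
      (solve 5 (λ S R W K N → W :* (con 0ℚ :- R) :+ (S :* K :- R :* N) := S :* K :- R :* (W :+ N))
             refl (ι s) (ι r) (w e) (sumᴸ w (kruskal es)) (sumᴸ w es))
    ... | no _ = trans (cong (w e ℚ.* (ι s ℚ.- ι r) ℚ.+_) (Σw·gain es))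
      (solve 5 (λ S R W K N → W :* (S :- R) :+ (S :* K :- R :* N) := S :* (W :+ K) :- R :* (W :+ N))
             refl (ι s) (ι r) (w e) (sumᴸ w (kruskal es)) (sumᴸ w es))

    Σgain-nonNeg : Unique xs → 0ℚ ≤ Σd xs
    Σgain-nonNeg {xs = es} u = subst (0ℚ ≤_) (sym (Σgain es)) (q≤p⇒0≤p-q (begin
      ι r ℚ.* ι (length es)            ≡⟨ ι-* r _ ⟨
      ι (r * length es)                ≤⟨ ι-mono (subst₂ (λ a b → r * a ℕ.≤ s * b)
                                            (∣toSubset∣ u) (rank-toSubset es) (dense (toSubset es))) ⟩
      ι (s * length (kruskal es))      ≡⟨ ι-* s _ ⟩
      ι s ℚ.* ι (length (kruskal es))  ∎))
      where open ℚₚ.≤-Reasoning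

    greedy-bound : ∀ {L} → Unique L → Linked (λ e f → w e ≤ w f) L → (∀ e → 0ℚ ≤ w e) →
                   ι r ℚ.* sumᴸ w L ≤ ι s ℚ.* sumᴸ w (kruskal L)
    greedy-bound {L} u sorted 0≤w = 0≤p-q⇒q≤p (subst (0ℚ ≤_) (Σw·gain L)
      (Σwd-nonNeg sorted 0≤w (All.map Σgain-nonNeg (tails-unique u))))

  -- byWeight is increasing, so kruskal offers the heaviest edges first.
  greedyTree : (Fin m → ℚ) → Subset m
  greedyTree w = toSubset (kruskal (byWeight w))

  greedyTree-spanningTree : Connected G → Fin n → ∀ w → SpanningTree G (greedyTree w)
  greedyTree-spanningTree connected v₀ w =
    kruskal-spanningTree connected v₀ (byWeight-unique w) (∈-byWeight w)

  greedyTree-heavy : ∀ w → (∀ e → 0ℚ ≤ w e) → ∀ {r s} → DensityAtMost s r →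
                     ι r ℚ.* sumᶠ w ≤ ι s ℚ.* treeWeight (greedyTree w) w
  greedyTree-heavy w 0≤w {r} {s} dense = subst₂ (λ a b → ι r ℚ.* a ≤ ι s ℚ.* b) Σ-all Σ-tree
    (greedy-bound w {r} {s} dense (byWeight-unique w) (byWeight-sorted w) 0≤w)
    where
    L = byWeight w
    Σ-all : sumᴸ w L ≡ sumᶠ w
    Σ-all = begin
      sumᴸ w L                   ≡⟨ treeWeight-toSubset w (byWeight-unique w) ⟨
      treeWeight (toSubset L) w  ≡⟨ cong (λ S → treeWeight S w) (⊆-antisym ⊆⊤ ⊤⊆L) ⟩
      treeWeight ⊤ w             ≡⟨ treeWeight-⊤ w ⟩
      sumᶠ w                     ∎
      where
      open ≡-Reasoning
      ⊤⊆L : ⊤ ⊆ toSubset L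
      ⊤⊆L {e} _ = ∈-toSubset⁺ (∈-byWeight w e)
    Σ-tree : sumᴸ w (kruskal L) ≡ treeWeight (greedyTree w) w
    Σ-tree = sym (treeWeight-toSubset w (kruskal-unique (byWeight-unique w)))

  -- ⊔ 1 changes rank B only for B = ⊥, whose density stays 0, and keeps denominators nonzero.
  rank⁺ : Subset m → ℕ
  rank⁺ B = rank B ℕ.⊔ 1

  open Densest ∣_∣ rank⁺ (λ B → ℕ.>-nonZero (ℕₚ.m≤n⊔m (rank B) 1))
    using (_≼_; densest; densest-greatest)

  S⋆ : Subset m
  S⋆ = densest ⊥ (allSubsets m)

  S⋆-maximal : ∀ B → B ≼ S⋆
  S⋆-maximal B = All.lookup (densest-greatest ⊥ (allSubsets m)) (there (∈-allSubsets B))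

  S⋆-densest : DensityAtMost ∣ S⋆ ∣ (rank⁺ S⋆)
  S⋆-densest B with nonempty? B
  ... | yes (e , e∈B) = subst₂ ℕ._≤_ (ℕₚ.*-comm ∣ B ∣ (rank⁺ S⋆))
                          (cong (∣ S⋆ ∣ *_) (ℕₚ.m≥n⇒m⊔n≡m (rank-pos e∈B))) (S⋆-maximal B)
  ... | no B-empty rewrite Empty-unique B-empty | ∣⊥∣≡0 m | ℕₚ.*-zeroʳ (rank⁺ S⋆) = ℕ.z≤n

  S⋆-nonZero : Fin m → ℕ.NonZero ∣ S⋆ ∣
  S⋆-nonZero e = ℕₚ.m*n≢0⇒m≢0 ∣ S⋆ ∣ {{ℕ.>-nonZero (ℕₚ.≤-trans 1≤r⋆ (S⋆-densest ⁅ e ⁆))}}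
    where
    1≤r⋆ : 1 ℕ.≤ rank⁺ S⋆ * ∣ ⁅ e ⁆ ∣
    1≤r⋆ = subst (λ k → 1 ℕ.≤ rank⁺ S⋆ * k) (sym (∣⁅x⁆∣≡1 e))
             (subst (1 ℕ.≤_) (sym (ℕₚ.*-identityʳ _)) (ℕₚ.m≤n⊔m (rank S⋆) 1))

  S⋆-greedy-bound : ∀ {T} → SpanningTree G T → ∀ w → (∀ e → 0ℚ ≤ w e) → sumᶠ w ≡ 1ℚ →
                    ι ∣ T ∩ S⋆ ∣ ≤ ι ∣ S⋆ ∣ ℚ.* treeWeight (greedyTree w) w
  S⋆-greedy-bound {T} tree w 0≤w Σw≡1 = begin
    ι ∣ T ∩ S⋆ ∣                              ≤⟨ ι-mono ∣T∩S⋆∣≤rank⁺ ⟩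
    ι (rank⁺ S⋆)                              ≡⟨ ℚₚ.*-identityʳ _ ⟨
    ι (rank⁺ S⋆) ℚ.* 1ℚ                       ≡⟨ cong (ι (rank⁺ S⋆) ℚ.*_) Σw≡1 ⟨
    ι (rank⁺ S⋆) ℚ.* sumᶠ w                   ≤⟨ greedyTree-heavy w 0≤w {rank⁺ S⋆} {∣ S⋆ ∣} S⋆-densest ⟩
    ι ∣ S⋆ ∣ ℚ.* treeWeight (greedyTree w) w  ∎
    where
    open ℚₚ.≤-Reasoning
    ∣T∩S⋆∣≤rank⁺ = ℕₚ.≤-trans (forest-bound tree S⋆) (ℕₚ.m≤m⊔n (rank S⋆) 1)

lemma3 : (G : Graph) → Connected G → 0 < Graph.m G →
    ∃[ w⋆ ] (((∀ e → 0ℚ ≤ w⋆ e) × sumᶠ w⋆ ≡ 1ℚ)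
    × (∀ (w : Fin (Graph.m G) → ℚ) → (∀ e → 0ℚ ≤ w e) → sumᶠ w ≡ 1ℚ →
    ∀ (T : Subset (Graph.m G)) → SpanningTree G T →
    ∃[ T′ ] (SpanningTree G T′ × treeWeight T w⋆ ≤ treeWeight T′ w))
    × (∀ e f → w⋆ e ≢ 0ℚ → w⋆ f ≢ 0ℚ → w⋆ e ≡ w⋆ f))
lemma3 G connected 0<m =
  uniform (S⋆ G) u , (uniform-nonNeg (S⋆ G) 0≤u , Σw⋆≡1) ,
  (λ w 0≤w Σw≡1 T tree → greedyTree G w , greedyTree-spanningTree G connected (Graph.src G e₀) w ,
     ℚₚ.≤-trans (ℚₚ.≤-reflexive (treeWeight-uniform T (S⋆ G) u))
                (p≤r*q⇒p*1/r≤q s⋆ (S⋆-greedy-bound G tree w 0≤w Σw≡1))) ,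
  uniform-equal (S⋆ G) u
  where
  e₀ = Fin.fromℕ< 0<m
  s⋆ : ℚ
  s⋆ = ι ∣ S⋆ G ∣
  instance
    s⋆-positive : ℚ.Positive s⋆
    s⋆-positive = ι-positive ∣ S⋆ G ∣ {{S⋆-nonZero G e₀}}
    s⋆-nonZero : ℚ.NonZero s⋆
    s⋆-nonZero = ℚₚ.pos⇒nonZero s⋆
  u : ℚ
  u = ℚ.1/ s⋆
  0≤u : 0ℚ ≤ u
  0≤u = ℚₚ.nonNegative⁻¹ u {{ℚₚ.pos⇒nonNeg u {{ℚₚ.1/pos⇒pos s⋆}}}}
  Σw⋆≡1 : sumᶠ (uniform (S⋆ G) u) ≡ 1ℚ
  Σw⋆≡1 = trans (treeWeight-const (S⋆ G) u) (ℚₚ.*-inverseʳ s⋆)
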